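{- For any tree $T$ with $m\geq 1$ edges and any $k\geq 2$, $f_k(n,T)=\Omega(n^{\frac{m+1}{m}})$.
   Context: All colourings are edge-colourings of the complete graph $K_n$; a colouring is proper if any two edges sharing a vertex receive different colours. Two copies of a graph $H$ in an edge-coloured $K_n$ are colour isomorphic if there is a graph isomorphism between them mapping each edge to an edge of the same colour. A $k$-repeat of $H$ is a collection of $k$ pairwise vertex-disjoint, pairwise colour-isomorphic copies of $H$. For integers $k,n\geq 2$ and a graph $H$, $f_k(n,H)$ is the smallest integer $C$ such that there is a proper edge-colouring of $K_n$ with $C$ colours containing no $k$-repeat of $H$. Asymptotic notation is with respect to $n\to\infty$ with $T,k$ fixed. -}

module Defs where

open import Data.Nat using (ℕ; zero; suc; _+_; _*_; _^_; _≤_; _<ᵇ_)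
open import Data.Fin using (Fin; toℕ)
open import Data.Bool using (Bool; true; false; _∧_; if_then_else_)
open import Data.List using (List; []; _∷_; _++_; [_]; length; map; allFin; cartesianProduct)
open import Data.Nat.ListAction using (sum)
open import Data.List.Relation.Unary.Linked using (Linked)
open import Data.List.Relation.Unary.Unique.Propositional using (Unique)
open import Data.Product using (Σ; _×_; _,_; proj₁; proj₂)
open import Relation.Binary.PropositionalEquality using (_≡_; _≢_)
open import Relation.Nullary using (¬_)

record Graph (v : ℕ) : Set where
  field
    adj    : Fin v → Fin v → Bool
    sym    : ∀ x y → adj x y ≡ adj y x
    irrefl : ∀ x → adj x x ≡ false
open Graph public

Edge : ∀ {v} → Graph v → Fin v → Fin v → Set
Edge G x y = adj G x y ≡ true

edgeCount : ∀ {v} → Graph v → ℕ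
edgeCount {v} G =
  sum (map (λ p → if (toℕ (proj₁ p) <ᵇ toℕ (proj₂ p)) ∧ adj G (proj₁ p) (proj₂ p) then 1 else 0)
           (cartesianProduct (allFin v) (allFin v)))

data Walk {v} (G : Graph v) : Fin v → Fin v → Set where
  here : ∀ {x} → Walk G x x
  step : ∀ {x y z} → Edge G x y → Walk G y z → Walk G x z

Connected : ∀ {v} → Graph v → Set
Connected G = ∀ x y → Walk G x y

-- a cycle: distinct vertices x, m₁, …, mₗ, y (l ≥ 1, so ≥ 3 vertices),
-- consecutive ones adjacent, and y adjacent to x
record Cycle {v} (G : Graph v) : Set where
  field
    first  : Fin v
    middle : List (Fin v)
    final  : Fin v
    long   : 1 ≤ length middle
    distinct : Unique (first ∷ middle ++ [ final ])
    path   : Linked (Edge G) (first ∷ middle ++ [ final ])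
    close  : Edge G final first

IsTree : ∀ {v} → Graph v → Set
IsTree G = Connected G × ¬ Cycle G

-- edge-colouring of K_n with colours from Fin C (value on diagonal irrelevant)
Colouring : ℕ → ℕ → Set
Colouring n C = Fin n → Fin n → Fin C

Proper : ∀ {n C} → Colouring n C → Set
Proper {n} c =
  (∀ x y → c x y ≡ c y x) ×
  (∀ x y z → x ≢ y → x ≢ z → y ≢ z → c x y ≢ c x z)

-- a k-repeat of H: k embeddings of H into K_n with pairwise disjoint images,
-- such that corresponding edges get the same colour in each copy
-- (so the copies are pairwise colour isomorphic via φ j ∘ (φ i)⁻¹).
KRepeat : ∀ {v n C} → Graph v → ℕ → Colouring n C → Set
KRepeat {v} {n} H k c =
  Σ (Fin k → Fin v → Fin n) λ φ →
    (∀ i x y → φ i x ≡ φ i y → x ≡ y) ×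
    (∀ i j x y → i ≢ j → φ i x ≢ φ j y) ×
    (∀ i j x y → Edge H x y → c (φ i x) (φ i y) ≡ c (φ j x) (φ j y))

-- Proof by counting copies of T.  Let T have v vertices.  A copy of T in K_n is a
-- duplicate-free v-tuple of vertices of K_n; its profile is the list of colours of
-- its m edges.
--   * Rigidity: as the colouring is proper and T is connected, two copies with the
--     same profile that agree at one vertex are equal.  So a copy meets at most v²
--     copies of its profile, and a greedy choice in a profile class with more than
--     k · v² members gives k disjoint colour-isomorphic copies, a k-repeat.  Hence
--     there are at most C ^ m · k · v² copies.
--   * There are at least (n / 2) ^ v duplicate-free v-tuples once n ≥ 2v.
--   * A tree has at most v - 1 edges, so n ^ (m + 1) ≤ n ^ v.
module Submission where

open import Defs
open import Level using (0ℓ)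
open import Function using (_∘_)
open import Function.Bundles using (Equivalence)
open import Data.Empty using (⊥-elim)
open import Data.Product using (Σ; _×_; _,_; proj₁; proj₂)
open import Data.Sum using (_⊎_; inj₁; inj₂)
open import Data.Bool using (Bool; true; false; _∧_; if_then_else_)
open import Data.Bool.Properties using (T-∧; T-≡)
open import Data.Nat using (ℕ; zero; suc; _+_; _*_; _^_; _≤_; _<_; _<ᵇ_; _∸_; z≤n; s≤s; >-nonZero)
open import Data.Nat.Properties hiding (_≟_)
open import Data.Nat.Solver using (module +-*-Solver)
open import Data.Nat.ListAction using (sum)
open import Data.Fin using (Fin; zero; suc; toℕ; _≟_)
open import Data.Fin.Properties using (all?; ¬∀⟶∃¬; toℕ-injective)
open import Data.List using (List; []; _∷_; _++_; [_]; _∷ʳ_; length; map; filter; concatMap; allFin; cartesianProduct; initLast; _∷ʳ′_)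
open import Data.List.Properties using (length-++; length-map; length-tabulate; ∷-injectiveˡ; ∷-injectiveʳ) renaming (≡-dec to ≡-decList)
open import Data.List.Membership.Propositional using (_∈_; find)
open import Data.List.Membership.Propositional.Properties using (∈-filter⁻; ∈-filter⁺; ∈-allFin; ∈-cartesianProduct⁺; ∈-map⁻; ∈-map⁺; ∈-concatMap⁻; ∈-concatMap⁺)
open import Data.List.Relation.Unary.All as All using (All; []; _∷_)
import Data.List.Relation.Unary.All.Properties as All
open import Data.List.Relation.Unary.Any as Any using (Any; here; there)
open import Data.List.Relation.Unary.AllPairs as AllPairs using ([]; _∷_)
import Data.List.Relation.Unary.AllPairs.Properties as AllPairs
open import Data.List.Relation.Unary.Linked as Linked using (Linked; [-]; _∷_)
open import Data.List.Relation.Unary.Unique.Propositional using (Unique)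
import Data.List.Relation.Unary.Unique.Propositional.Properties as Unique
open import Data.List.Relation.Binary.Sublist.Propositional.Properties using (filter⁺; filter-⊆; length-mono-≤)
open import Data.Vec using (Vec; []; _∷_; lookup; toList)
import Data.Vec.Properties as Vec
open import Data.Vec.Properties using (length-toList; tabulate∘lookup; tabulate-cong)
import Data.Vec.Relation.Unary.Any as VecAny
import Data.Vec.Relation.Unary.Any.Properties as VecAny
open import Data.Vec.Relation.Unary.All using ([]; _∷_) renaming (All to AllV)
open import Data.Vec.Relation.Unary.AllPairs using ([]; _∷_)
open import Data.Vec.Relation.Unary.Unique.Propositional using () renaming (Unique to Distinct)
open import Data.Vec.Relation.Unary.Unique.Propositional.Properties using (lookup-injective)
import Data.Vec.Membership.Propositional as VecMembership
import Data.Vec.Membership.DecPropositional as VecDecMembership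
open import Relation.Nullary using (¬_; Dec; yes; no)
open import Relation.Nullary.Decidable using (¬?; T?; decidable-stable)
open import Relation.Unary using (Pred; Decidable)
open import Relation.Binary using (Rel; DecidableEquality; tri<; tri≈; tri>)
open import Relation.Binary.PropositionalEquality as ≡ using (_≡_; _≢_; refl; trans; cong; cong₂; subst)
open import Relation.Binary.Construct.Closure.ReflexiveTransitive as Star using (Star; ε; _◅_; _◅◅_)

open ≤-Reasoning

module _ {A : Set} {P : Pred A 0ℓ} (P? : Decidable P) where

  length-filter-split : ∀ xs → length xs ≡ length (filter P? xs) + length (filter (¬? ∘ P?) xs)
  length-filter-split [] = refl
  length-filter-split (x ∷ xs) with P? x
  ... | yes _ = cong suc (length-filter-split xs)
  ... | no _  = trans (cong suc (length-filter-split xs)) (≡.sym (+-suc _ _))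

  length-filter-filter : ∀ {R : Pred A 0ℓ} (R? : Decidable R) xs →
                         length (filter P? (filter R? xs)) ≤ length (filter P? xs)
  length-filter-filter R? xs = length-mono-≤ (filter⁺ P? P? (λ { refl p → p }) (filter-⊆ R? xs))

count-indicator : ∀ {B : Set} (b : B → Bool) (L : List B) →
                  sum (map (λ p → if b p then 1 else 0) L) ≡ length (filter (T? ∘ b) L)
count-indicator b []      = refl
count-indicator b (p ∷ L) with b p
... | true  = cong suc (count-indicator b L)
... | false = count-indicator b L

length-allFin : ∀ n → length (allFin n) ≡ n
length-allFin n = length-tabulate (λ i → i)

length-cartesianProduct : ∀ {A B : Set} (xs : List A) (ys : List B) →
                          length (cartesianProduct xs ys) ≡ length xs * length ys
length-cartesianProduct []       ys = refl
length-cartesianProduct (x ∷ xs) ys = begin-equality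
  length (map (x ,_) ys ++ cartesianProduct xs ys)            ≡⟨ length-++ (map (x ,_) ys) ⟩
  length (map (x ,_) ys) + length (cartesianProduct xs ys)    ≡⟨ cong₂ _+_ (length-map (x ,_) ys) (length-cartesianProduct xs ys) ⟩
  length ys + length xs * length ys                           ∎

module _ {A B : Set} (f : A → List B) where

  length-concatMap-≤ : ∀ xs {b} → (∀ {x} → x ∈ xs → length (f x) ≤ b) → length (concatMap f xs) ≤ length xs * b
  length-concatMap-≤ []       _     = z≤n
  length-concatMap-≤ (x ∷ xs) {b} short = begin
      length (concatMap f (x ∷ xs))          ≡⟨ length-++ (f x) ⟩
      length (f x) + length (concatMap f xs) ≤⟨ +-mono-≤ (short (here refl)) (length-concatMap-≤ xs (short ∘ there)) ⟩
      b + length xs * b                      ∎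

  length-concatMap-≥ : ∀ xs {b} → (∀ {x} → x ∈ xs → b ≤ length (f x)) → length xs * b ≤ length (concatMap f xs)
  length-concatMap-≥ []       _    = z≤n
  length-concatMap-≥ (x ∷ xs) {b} long = begin
      b + length xs * b                      ≤⟨ +-mono-≤ (long (here refl)) (length-concatMap-≥ xs (long ∘ there)) ⟩
      length (f x) + length (concatMap f xs) ≡⟨ ≡.sym (length-++ (f x)) ⟩
      length (concatMap f (x ∷ xs))          ∎

unique-constant-≤1 : ∀ {A : Set} (xs : List A) → Unique xs → (∀ {a b} → a ∈ xs → b ∈ xs → a ≡ b) → length xs ≤ 1
unique-constant-≤1 []            _                  _  = z≤n
unique-constant-≤1 (x ∷ [])      _                  _  = s≤s z≤n
unique-constant-≤1 (x ∷ y ∷ xs) ((x≢y ∷ _) ∷ _) same = ⊥-elim (x≢y (same (here refl) (there (here refl))))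

module _ {A B : Set} {Q : B → A → Set} (Q? : ∀ p → Decidable (Q p)) where

  fibre-bound : ∀ (ps : List B) (xs : List A) {b} →
                (∀ {x} → x ∈ xs → Any (λ p → Q p x) ps) →
                (∀ p → length (filter (Q? p) xs) ≤ b) →
                length xs ≤ length ps * b
  fibre-bound [] []       _     _ = z≤n
  fibre-bound [] (x ∷ xs) cover _ with cover (here refl)
  ... | ()
  fibre-bound (p ∷ ps) xs {b} cover fibre = begin
      length xs                                              ≡⟨ length-filter-split (Q? p) xs ⟩
      length (filter (Q? p) xs) + length outside             ≤⟨ +-mono-≤ (fibre p) (fibre-bound ps outside cover′ fibre′) ⟩
      b + length ps * b                                      ∎
    where
      outside : List A
      outside = filter (¬? ∘ Q? p) xs
      cover′ : ∀ {x} → x ∈ outside → Any (λ p → Q p x) ps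
      cover′ x∈ = let (x∈xs , ¬Qpx) = ∈-filter⁻ (¬? ∘ Q? p) {xs = xs} x∈ in Any.tail ¬Qpx (cover x∈xs)
      fibre′ : ∀ p′ → length (filter (Q? p′) outside) ≤ b
      fibre′ p′ = ≤-trans (length-filter-filter (Q? p′) (¬? ∘ Q? p) xs) (fibre p′)

  injection-bound : ∀ (ps : List B) (xs : List A) → Unique xs →
                    (∀ {x} → x ∈ xs → Any (λ p → Q p x) ps) →
                    (∀ p {x y} → x ∈ xs → y ∈ xs → Q p x → Q p y → x ≡ y) →
                    length xs ≤ length ps
  injection-bound ps xs uniq cover inj = begin
      length xs       ≤⟨ fibre-bound ps xs cover fibre≤1 ⟩
      length ps * 1   ≡⟨ *-identityʳ (length ps) ⟩
      length ps       ∎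
    where
      fibre≤1 : ∀ p → length (filter (Q? p) xs) ≤ 1
      fibre≤1 p = unique-constant-≤1 _ (Unique.filter⁺ (Q? p) uniq) λ a∈ b∈ →
        let (a∈xs , Qpa) = ∈-filter⁻ (Q? p) {xs = xs} a∈
            (b∈xs , Qpb) = ∈-filter⁻ (Q? p) {xs = xs} b∈
        in inj p a∈xs b∈xs Qpa Qpb

unique-⊆-length : ∀ {A : Set} (_≟_ : DecidableEquality A) {xs ys : List A} → Unique xs →
                  (∀ {x} → x ∈ xs → x ∈ ys) → length xs ≤ length ys
unique-⊆-length _≟_ {xs} {ys} uniq ⊆ =
  injection-bound (λ p x → p ≟ x) ys xs uniq (Any.map ≡.sym ∘ ⊆) (λ _ _ _ p≡x p≡y → trans (≡.sym p≡x) p≡y)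

module _ {A : Set} {D : A → A → Set} (D? : ∀ a b → Dec (D a b)) (D-sym : ∀ a b → D a b → D b a) where

  -- Call a and b compatible when D a b holds.  If every
  -- member of S is incompatible with at most b members of S and |S| > k · b,
  -- then S contains k pairwise compatible members: pick the first element,
  -- discard the (at most b) elements incompatible with it, and recurse.
  greedy-selection : ∀ k (S : List A) {b} →
                     (∀ {a} → a ∈ S → length (filter (¬? ∘ D? a) S) ≤ b) → k * b < length S →
                     Σ (Fin k → A) λ ψ → (∀ i → ψ i ∈ S) × (∀ i j → i ≢ j → D (ψ i) (ψ j))
  greedy-selection zero    S       _      _  = (λ ()) , (λ ()) , (λ ())
  greedy-selection (suc k) []      _      ()
  greedy-selection (suc k) (a ∷ S) {b} few big = ψ , ψ∈ , ψ-compatible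
    where
      S′ : List A
      S′ = filter (D? a) (a ∷ S)

      S′-big : k * b < length S′
      S′-big = +-cancelʳ-≤ b (suc (k * b)) (length S′) (begin
        suc (k * b) + b                                        ≡⟨ +-comm (suc (k * b)) b ⟩
        b + suc (k * b)                                        ≡⟨ +-suc b (k * b) ⟩
        suc (b + k * b)                                        ≤⟨ big ⟩
        length (a ∷ S)                                         ≡⟨ length-filter-split (D? a) (a ∷ S) ⟩
        length S′ + length (filter (¬? ∘ D? a) (a ∷ S))        ≤⟨ +-monoʳ-≤ (length S′) (few (here refl)) ⟩
        length S′ + b                                          ∎)

      S′-few : ∀ {c} → c ∈ S′ → length (filter (¬? ∘ D? c) S′) ≤ b
      S′-few {c} c∈ = ≤-trans (length-filter-filter (¬? ∘ D? c) (D? a) (a ∷ S))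
                              (few (proj₁ (∈-filter⁻ (D? a) {xs = a ∷ S} c∈)))

      chosen : Σ (Fin k → A) λ φ → (∀ i → φ i ∈ S′) × (∀ i j → i ≢ j → D (φ i) (φ j))
      chosen = greedy-selection k S′ S′-few S′-big

      φ : Fin k → A
      φ = proj₁ chosen

      φ∈S′ : ∀ i → φ i ∈ S′
      φ∈S′ = proj₁ (proj₂ chosen)

      ψ : Fin (suc k) → A
      ψ zero    = a
      ψ (suc i) = φ i

      ψ∈ : ∀ i → ψ i ∈ a ∷ S
      ψ∈ zero    = here refl
      ψ∈ (suc i) = proj₁ (∈-filter⁻ (D? a) {xs = a ∷ S} (φ∈S′ i))

      compatible-with-a : ∀ i → D a (φ i)
      compatible-with-a i = proj₂ (∈-filter⁻ (D? a) {xs = a ∷ S} (φ∈S′ i))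

      ψ-compatible : ∀ i j → i ≢ j → D (ψ i) (ψ j)
      ψ-compatible zero    zero    i≢j = ⊥-elim (i≢j refl)
      ψ-compatible zero    (suc j) _   = compatible-with-a j
      ψ-compatible (suc i) zero    _   = D-sym a (φ i) (compatible-with-a i)
      ψ-compatible (suc i) (suc j) i≢j = proj₂ (proj₂ chosen) i j (i≢j ∘ cong suc)

module _ {A : Set} where

  lastOf : A → List A → A
  lastOf x []       = x
  lastOf x (y ∷ ys) = lastOf y ys

  next : A → List A → A
  next x []      = x
  next x (y ∷ _) = y

  lastOf-∈ : ∀ x xs → lastOf x xs ∈ x ∷ xs
  lastOf-∈ x []       = here refl
  lastOf-∈ x (y ∷ ys) = there (lastOf-∈ y ys)

  lastOf-∷ʳ : ∀ x xs y → lastOf x (xs ∷ʳ y) ≡ y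
  lastOf-∷ʳ x []       y = refl
  lastOf-∷ʳ x (z ∷ zs) y = lastOf-∷ʳ z zs y

  unique-lastOf : ∀ x xs → Unique (x ∷ xs) → lastOf x xs ≡ x → xs ≡ []
  unique-lastOf x []       _          _      = refl
  unique-lastOf x (y ∷ ys) (x∉ys ∷ _) last≡x = ⊥-elim (All.lookup x∉ys (lastOf-∈ y ys) (≡.sym last≡x))

  record SimplePath (R : Rel A 0ℓ) (x y : A) : Set where
    constructor simplePath
    field
      rest     : List A
      linked   : Linked R (x ∷ rest)
      distinct : Unique (x ∷ rest)
      ends     : lastOf x rest ≡ y
  open SimplePath public

  suffix : ∀ {R z y} (p : SimplePath R z y) {x} → x ∈ z ∷ rest p → SimplePath R x y
  suffix p                                       (here refl) = p
  suffix (simplePath (w ∷ ws) (_ ∷ l) (_ ∷ u) e) (there x∈)  = suffix (simplePath ws l u e) x∈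

  -- A step x → z in front of a simple path from z either revisits x, and then
  -- the loop is cut off by taking the suffix from x, or x is prepended.
  loop-erase : ∀ (_≟_ : DecidableEquality A) {R x y} → Star R x y → SimplePath R x y
  loop-erase _≟_ ε = simplePath [] [-] ([] ∷ []) refl
  loop-erase _≟_ {x = x} (r ◅ w) with loop-erase _≟_ w
  ... | p@(simplePath zs l u e) with Any.any? (x ≟_) (_ ∷ zs)
  ...   | yes x∈ = suffix p x∈
  ...   | no  x∉ = simplePath (_ ∷ zs) (r ∷ l) (All.¬Any⇒All¬ _ x∉ ∷ u) e

module _ {v} (G : Graph v) where

  Edge-sym : ∀ {x y} → Edge G x y → Edge G y x
  Edge-sym {x} {y} e = trans (Graph.sym G y x) e

  Edge-irrefl : ∀ {x y} → Edge G x y → x ≢ y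
  Edge-irrefl {x} e refl with trans (≡.sym e) (irrefl G x)
  ... | ()

  walk→star : ∀ {x y} → Walk G x y → Star (Edge G) x y
  walk→star here       = ε
  walk→star (step e w) = e ◅ walk→star w

  EdgeAvoiding : Fin v → Fin v → Rel (Fin v) 0ℓ
  EdgeAvoiding a b u w = Edge G u w × ¬ (u ≡ a × w ≡ b) × ¬ (u ≡ b × w ≡ a)

  EdgeAvoiding-sym : ∀ {a b u w} → EdgeAvoiding a b u w → EdgeAvoiding a b w u
  EdgeAvoiding-sym (e , not-ab , not-ba) =
    Edge-sym e , (λ (w≡a , u≡b) → not-ba (u≡b , w≡a)) , (λ (w≡b , u≡a) → not-ab (u≡a , w≡b))

  EdgeAvoiding-swap : ∀ {a b u w} → EdgeAvoiding a b u w → EdgeAvoiding b a u w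
  EdgeAvoiding-swap (e , not-ab , not-ba) = e , not-ba , not-ab

  avoid-vertex : ∀ {a b u} us → All (a ≢_) (u ∷ us) → Linked (Edge G) (u ∷ us) →
                 Star (EdgeAvoiding a b) u (lastOf u us)
  avoid-vertex []       _                  _         = ε
  avoid-vertex (w ∷ ws) (a≢u ∷ a≢w ∷ a∉) (e ∷ l) =
    (e , (λ (u≡a , _) → a≢u (≡.sym u≡a)) , (λ (_ , w≡a) → a≢w (≡.sym w≡a))) ◅ avoid-vertex ws (a≢w ∷ a∉) l

  avoid-edge : ∀ {a b r} (p : SimplePath (Edge G) a r) → a ≢ b → next a (rest p) ≢ b →
               Star (EdgeAvoiding a b) a r
  avoid-edge (simplePath []       _       _          a≡r) _   _   = subst (Star _ _) a≡r ε
  avoid-edge (simplePath (z ∷ zs) (e ∷ l) (a∉ ∷ _) ends) a≢b z≢b =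
    subst (Star _ _) ends (first-step ◅ avoid-vertex zs a∉ l)
    where
      first-step : EdgeAvoiding _ _ _ _
      first-step = e , (λ (_ , z≡b) → z≢b z≡b) , (λ (a≡b , _) → a≢b a≡b)

  cycle-from-detour : ∀ {a b} → Edge G a b → SimplePath (EdgeAvoiding a b) a b → Cycle G
  cycle-from-detour {a} {b} eab (simplePath rest linked distinct ends) with initLast rest
  ... | []             = ⊥-elim (Edge-irrefl eab ends)
  ... | [] ∷ʳ′ y       = ⊥-elim (proj₁ (proj₂ (Linked.head linked)) (refl , ends))
  ... | (m ∷ mid) ∷ʳ′ y = record
    { first    = a
    ; middle   = m ∷ mid
    ; final    = b
    ; long     = s≤s z≤n
    ; distinct = subst (λ t → Unique (a ∷ (m ∷ mid) ++ [ t ])) y≡b distinct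
    ; path     = subst (λ t → Linked (Edge G) (a ∷ (m ∷ mid) ++ [ t ])) y≡b (Linked.map proj₁ linked)
    ; close    = Edge-sym eab
    }
    where
      y≡b : y ≡ b
      y≡b = trans (≡.sym (lastOf-∷ʳ a (m ∷ mid) y)) ends

module EdgeList {v} (G : Graph v) where

  vertexPairs : List (Fin v × Fin v)
  vertexPairs = cartesianProduct (allFin v) (allFin v)

  isOrderedEdge : Fin v × Fin v → Bool
  isOrderedEdge p = (toℕ (proj₁ p) <ᵇ toℕ (proj₂ p)) ∧ adj G (proj₁ p) (proj₂ p)

  edges : List (Fin v × Fin v)
  edges = filter (T? ∘ isOrderedEdge) vertexPairs

  edgeCount≡length : edgeCount G ≡ length edges
  edgeCount≡length = count-indicator isOrderedEdge vertexPairs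

  edges-unique : Unique edges
  edges-unique = Unique.filter⁺ _ (Unique.cartesianProduct⁺ (Unique.allFin⁺ v) (Unique.allFin⁺ v))

  ∈-edges⁻ : ∀ {x y} → (x , y) ∈ edges → toℕ x < toℕ y × Edge G x y
  ∈-edges⁻ {x} {y} xy∈ =
    let (x<ᵇy , exy) = Equivalence.to T-∧ (proj₂ (∈-filter⁻ (T? ∘ isOrderedEdge) {xs = vertexPairs} xy∈))
    in <ᵇ⇒< (toℕ x) (toℕ y) x<ᵇy , Equivalence.to T-≡ exy

  ∈-edges⁺ : ∀ {x y} → toℕ x < toℕ y → Edge G x y → (x , y) ∈ edges
  ∈-edges⁺ {x} {y} x<y exy =
    ∈-filter⁺ (T? ∘ isOrderedEdge) (∈-cartesianProduct⁺ (∈-allFin x) (∈-allFin y))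
              (Equivalence.from T-∧ (<⇒<ᵇ x<y , Equivalence.from T-≡ exy))

SameEnds : ∀ {A : Set} → A → A → A → A → Set
SameEnds a b x y = (x ≡ a × y ≡ b) ⊎ (x ≡ b × y ≡ a)

same-ends-degenerate : ∀ {A : Set} {a b x y : A} → b ≡ a → SameEnds a b x y → x ≡ y
same-ends-degenerate refl (inj₁ (refl , refl)) = refl
same-ends-degenerate refl (inj₂ (refl , refl)) = refl

same-ends-ordered : ∀ {n} {a b x y x′ y′ : Fin n} → toℕ x < toℕ y → toℕ x′ < toℕ y′ →
                    SameEnds a b x y → SameEnds a b x′ y′ → (x , y) ≡ (x′ , y′)
same-ends-ordered _   _     (inj₁ (refl , refl)) (inj₁ (refl , refl)) = refl
same-ends-ordered _   _     (inj₂ (refl , refl)) (inj₂ (refl , refl)) = refl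
same-ends-ordered x<y x′<y′ (inj₁ (refl , refl)) (inj₂ (refl , refl)) = ⊥-elim (<-asym x<y x′<y′)
same-ends-ordered x<y x′<y′ (inj₂ (refl , refl)) (inj₁ (refl , refl)) = ⊥-elim (<-asym x<y x′<y′)

-- Root the tree at vertex 0 and
-- give every vertex its parent, the next vertex on a simple path to the root;
-- every edge joins a vertex to its parent, so "the endpoint farther from the
-- root" maps edges injectively to the v non-root vertices.
module RootedTree {v} (T : Graph (suc v)) (connected : Connected T) (acyclic : ¬ Cycle T) where

  root : Fin (suc v)
  root = zero

  toRoot : ∀ x → SimplePath (Edge T) x root
  toRoot x = loop-erase _≟_ (walk→star T (connected x root))

  parent : Fin (suc v) → Fin (suc v)
  parent x = next x (rest (toRoot x))

  parent-root : parent root ≡ root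
  parent-root = cong (next root) (unique-lastOf root (rest p) (distinct p) (ends p))
    where p = toRoot root

  -- If neither endpoint of the edge xy is the parent of the other, the paths
  -- to the root from x and from y avoid the edge xy, so they yield a cycle.
  edge-parent : ∀ {x y} → Edge T x y → parent x ≡ y ⊎ parent y ≡ x
  edge-parent {x} {y} exy with parent x ≟ y | parent y ≟ x
  ... | yes px≡y | _        = inj₁ px≡y
  ... | no _     | yes py≡x = inj₂ py≡x
  ... | no px≢y  | no py≢x  = ⊥-elim (acyclic (cycle-from-detour T exy (loop-erase _≟_ detour)))
    where
      x≢y = Edge-irrefl T exy
      from-x : Star (EdgeAvoiding T x y) x root
      from-x = avoid-edge T (toRoot x) x≢y px≢y
      from-y : Star (EdgeAvoiding T x y) y root
      from-y = Star.map (EdgeAvoiding-swap T) (avoid-edge T (toRoot y) (x≢y ∘ ≡.sym) py≢x)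
      detour : Star (EdgeAvoiding T x y) x y
      detour = from-x ◅◅ Star.reverse (EdgeAvoiding-sym T) from-y

  child : Fin (suc v) × Fin (suc v) → Fin (suc v)
  child (x , y) with parent x ≟ y
  ... | yes _ = x
  ... | no  _ = y

  child-spec : ∀ {x y} → Edge T x y → SameEnds (child (x , y)) (parent (child (x , y))) x y
  child-spec {x} {y} exy with parent x ≟ y
  ... | yes px≡y = inj₁ (refl , ≡.sym px≡y)
  ... | no  px≢y with edge-parent exy
  ...   | inj₁ px≡y = ⊥-elim (px≢y px≡y)
  ...   | inj₂ py≡x = inj₂ (≡.sym py≡x , refl)

  child-nonroot : ∀ {x y} → Edge T x y → child (x , y) ≢ root
  child-nonroot exy c≡root =
    Edge-irrefl T exy (same-ends-degenerate (trans (cong parent c≡root) (trans parent-root (≡.sym c≡root))) (child-spec exy))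

  open EdgeList T

  child-injective : ∀ {e e′} → e ∈ edges → e′ ∈ edges → child e ≡ child e′ → e ≡ e′
  child-injective {x , y} {x′ , y′} e∈ e′∈ same-child
    with ∈-edges⁻ e∈ | ∈-edges⁻ e′∈
  ... | x<y , exy | x′<y′ , ex′y′ =
    same-ends-ordered x<y x′<y′ (child-spec exy)
      (subst (λ c → SameEnds c (parent c) x′ y′) (≡.sym same-child) (child-spec ex′y′))

  edgeCount-≤ : edgeCount T ≤ v
  edgeCount-≤ = begin
    edgeCount T      ≡⟨ edgeCount≡length ⟩
    length edges     ≤⟨ injection-bound (λ c e → child e ≟ suc c) (allFin v) edges edges-unique cover
                          (λ c e∈ e′∈ ce≡c ce′≡c → child-injective e∈ e′∈ (trans ce≡c (≡.sym ce′≡c))) ⟩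
    length (allFin v) ≡⟨ length-allFin v ⟩
    v                ∎
    where
      cover : ∀ {e} → e ∈ edges → Any (λ c → child e ≡ suc c) (allFin v)
      cover {e} e∈ with child e | child-nonroot (proj₂ (∈-edges⁻ e∈))
      ... | zero  | nonroot = ⊥-elim (nonroot refl)
      ... | suc c | _       = Any.map (cong suc) (∈-allFin c)

double-remainder : ∀ n j → 2 * j ≤ n → n ≤ 2 * (n ∸ j)
double-remainder n j 2j≤n = begin
    n                          ≡⟨ ≡.sym (m+[n∸m]≡n (≤-trans (m≤m+n j (j + 0)) 2j≤n)) ⟩
    j + (n ∸ j)                ≤⟨ +-monoˡ-≤ (n ∸ j) (m+n≤o⇒m≤o∸n j (subst (_≤ n) (cong (j +_) (+-identityʳ j)) 2j≤n)) ⟩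
    (n ∸ j) + (n ∸ j)          ≡⟨ cong ((n ∸ j) +_) (≡.sym (+-identityʳ (n ∸ j))) ⟩
    2 * (n ∸ j)                ∎

-- Arrangements: the duplicate-free j-tuples of elements of Fin n, listed
-- without repetition.  For 2j ≤ n there are at least (n/2)^j of them.
module Arrangements (n : ℕ) where
  open VecMembership using () renaming (_∈_ to _∈ᵥ_; _∉_ to _∉ᵥ_)
  open VecDecMembership (_≟_ {n}) using (_∈?_)

  ∉⇒fresh : ∀ {j x} (e : Vec (Fin n) j) → x ∉ᵥ e → AllV (x ≢_) e
  ∉⇒fresh []      _   = []
  ∉⇒fresh (y ∷ e) x∉ = (x∉ ∘ VecAny.here) ∷ ∉⇒fresh e (x∉ ∘ VecAny.there)

  fresh : ∀ {j} → Vec (Fin n) j → List (Fin n)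
  fresh e = filter (¬? ∘ (_∈? e)) (allFin n)

  extensions : ∀ {j} → Vec (Fin n) j → List (Vec (Fin n) (suc j))
  extensions e = map (_∷ e) (fresh e)

  arrangements : ∀ j → List (Vec (Fin n) j)
  arrangements zero    = [ [] ]
  arrangements (suc j) = concatMap extensions (arrangements j)

  arrangement-distinct : ∀ j {e} → e ∈ arrangements j → Distinct e
  arrangement-distinct zero    (here refl) = []
  arrangement-distinct (suc j) e∈ with find (∈-concatMap⁻ (extensions {j}) {xs = arrangements j} e∈)
  ... | e′ , e′∈ , e∈ext with ∈-map⁻ (_∷ e′) e∈ext
  ...   | x , x∈fresh , refl =
    ∉⇒fresh e′ (proj₂ (∈-filter⁻ (¬? ∘ (_∈? e′)) {xs = allFin n} x∈fresh)) ∷ arrangement-distinct j e′∈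

  arrangements-unique : ∀ j → Unique (arrangements j)
  arrangements-unique zero    = [] ∷ []
  arrangements-unique (suc j) =
    Unique.concat⁺ (All.map⁺ (All.universal extensions-unique (arrangements j)))
                   (AllPairs.map⁺ (AllPairs.map extensions-disjoint (arrangements-unique j)))
    where
      extensions-unique : ∀ e → Unique (extensions e)
      extensions-unique e = Unique.map⁺ Vec.∷-injectiveˡ (Unique.filter⁺ (¬? ∘ (_∈? e)) (Unique.allFin⁺ n))
      extensions-disjoint : ∀ {e e′} → e ≢ e′ → ∀ {w} → ¬ (w ∈ extensions e × w ∈ extensions e′)
      extensions-disjoint {e} {e′} e≢e′ (w∈ , w∈′) with ∈-map⁻ (_∷ e) w∈ | ∈-map⁻ (_∷ e′) w∈′
      ... | _ , _ , refl | _ , _ , same = e≢e′ (Vec.∷-injectiveʳ same)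

  -- At most j elements of Fin n occur in a j-tuple, so at least n - j are fresh.
  extensions-length : ∀ {j} (e : Vec (Fin n) j) → n ∸ j ≤ length (extensions e)
  extensions-length {j} e = begin
      n ∸ j                      ≤⟨ m≤n+o⇒m∸n≤o n j n≤used+fresh ⟩
      length (fresh e)           ≡⟨ ≡.sym (length-map (_∷ e) (fresh e)) ⟩
      length (extensions e)      ∎
    where
      used : List (Fin n)
      used = filter (_∈? e) (allFin n)
      used-length : length used ≤ j
      used-length = begin
        length used                ≤⟨ unique-⊆-length _≟_ {ys = toList e} (Unique.filter⁺ (_∈? e) (Unique.allFin⁺ n))
                                        (λ x∈ → VecAny.toList⁺ (proj₂ (∈-filter⁻ (_∈? e) {xs = allFin n} x∈))) ⟩
        length (toList e)          ≡⟨ length-toList e ⟩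
        j                          ∎
      n≤used+fresh : n ≤ j + length (fresh e)
      n≤used+fresh = begin
        n                                  ≡⟨ ≡.sym (length-allFin n) ⟩
        length (allFin n)                  ≡⟨ length-filter-split (_∈? e) (allFin n) ⟩
        length used + length (fresh e)     ≤⟨ +-monoˡ-≤ (length (fresh e)) used-length ⟩
        j + length (fresh e)               ∎

  -- Each j-arrangement has at least n - j ≥ n / 2 extensions (for 2(j + 1) ≤ n).
  arrangements-length : ∀ j → 2 * j ≤ n → n ^ j ≤ 2 ^ j * length (arrangements j)
  arrangements-length zero    _    = s≤s z≤n
  arrangements-length (suc j) 2j+2≤n = begin
      n * n ^ j                                       ≤⟨ *-mono-≤ (double-remainder n j 2j≤n) (arrangements-length j 2j≤n) ⟩
      (2 * (n ∸ j)) * (2 ^ j * length (arrangements j)) ≡⟨ rearrange (n ∸ j) (2 ^ j) (length (arrangements j)) ⟩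
      (2 * 2 ^ j) * (length (arrangements j) * (n ∸ j)) ≤⟨ *-monoʳ-≤ (2 * 2 ^ j) (length-concatMap-≥ extensions (arrangements j) (λ {e} _ → extensions-length e)) ⟩
      (2 * 2 ^ j) * length (arrangements (suc j))       ∎
    where
      2j≤n : 2 * j ≤ n
      2j≤n = ≤-trans (*-monoʳ-≤ 2 (n≤1+n j)) 2j+2≤n
      open +-*-Solver
      rearrange : ∀ a b c → (2 * a) * (b * c) ≡ (2 * b) * (c * a)
      rearrange = solve 3 (λ a b c → (con 2 :* a) :* (b :* c) := (con 2 :* b) :* (c :* a)) refl

module Words (C : ℕ) where

  words : ℕ → List (List (Fin C))
  words zero    = [ [] ]
  words (suc m) = concatMap (λ w → map (_∷ w) (allFin C)) (words m)

  words-length : ∀ m → length (words m) ≤ C ^ m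
  words-length zero    = ≤-refl
  words-length (suc m) = begin
    length (words (suc m)) ≤⟨ length-concatMap-≤ (λ w → map (_∷ w) (allFin C)) (words m)
                                (λ {w} _ → ≤-reflexive (trans (length-map (_∷ w) (allFin C)) (length-allFin C))) ⟩
    length (words m) * C   ≤⟨ *-monoˡ-≤ C (words-length m) ⟩
    C ^ m * C              ≡⟨ *-comm (C ^ m) C ⟩
    C ^ suc m              ∎

  ∈-words : ∀ w → w ∈ words (length w)
  ∈-words []      = here refl
  ∈-words (x ∷ w) = ∈-concatMap⁺ (λ w → map (_∷ w) (allFin C)) (Any.map (λ { refl → ∈-map⁺ (_∷ w) (∈-allFin x) }) (∈-words w))

map-≡⇒≡ : ∀ {A B : Set} (f g : A → B) {xs} → map f xs ≡ map g xs → ∀ {x} → x ∈ xs → f x ≡ g x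
map-≡⇒≡ f g {_ ∷ _} eq (here refl) = ∷-injectiveˡ eq
map-≡⇒≡ f g {_ ∷ _} eq (there x∈) = map-≡⇒≡ f g (∷-injectiveʳ eq) x∈

lookup-ext : ∀ {A : Set} {j} (a b : Vec A j) → (∀ i → lookup a i ≡ lookup b i) → a ≡ b
lookup-ext a b same = trans (≡.sym (tabulate∘lookup a)) (trans (tabulate-cong same) (tabulate∘lookup b))

proper-unique-neighbour : ∀ {n C} {c : Colouring n C} → Proper c →
                          ∀ {x y z} → x ≢ y → x ≢ z → c x y ≡ c x z → y ≡ z
proper-unique-neighbour proper {x} {y} {z} x≢y x≢z same-colour with y ≟ z
... | yes y≡z = y≡z
... | no  y≢z = ⊥-elim (proj₂ proper x y z x≢y x≢z y≢z same-colour)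

-- A copy is a
-- duplicate-free tuple e (vertex i of T goes to lookup e i); its profile is the
-- list of colours of its edges, in the order of EdgeList.edges.
module Copies {v} (T : Graph v) (connected : Connected T) {n C} (c : Colouring n C) (proper : Proper c) where
  open EdgeList T
  open Arrangements n

  image : Vec (Fin n) v → Fin v × Fin v → Fin C
  image e (x , y) = c (lookup e x) (lookup e y)

  profile : Vec (Fin n) v → List (Fin C)
  profile e = map (image e) edges

  profile-length : ∀ e → length (profile e) ≡ edgeCount T
  profile-length e = trans (length-map (image e) edges) (≡.sym edgeCount≡length)

  same-profile-colours : ∀ e e′ → profile e ≡ profile e′ →
                         ∀ {x y} → Edge T x y → image e (x , y) ≡ image e′ (x , y)
  same-profile-colours e e′ same {x} {y} exy with <-cmp (toℕ x) (toℕ y)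
  ... | tri< x<y _ _ = map-≡⇒≡ (image e) (image e′) same (∈-edges⁺ x<y exy)
  ... | tri≈ _ x≡y _ = ⊥-elim (Edge-irrefl T exy (toℕ-injective x≡y))
  ... | tri> _ _ y<x =   -- the edge is listed as (y , x); use the symmetry of c
    trans (proj₁ proper _ _) (trans (map-≡⇒≡ (image e) (image e′) same (∈-edges⁺ y<x (Edge-sym T exy))) (proj₁ proper _ _))

  rigidity : ∀ {e e′} → Distinct e → Distinct e′ → profile e ≡ profile e′ →
             ∀ y → lookup e y ≡ lookup e′ y → e ≡ e′
  rigidity {e} {e′} distinct distinct′ same y agree-y =
    lookup-ext e e′ (λ z → agree-along (connected y z) agree-y)
    where
      -- Agreement at u propagates along an edge uw: both copies send w to the
      -- neighbour of lookup e u with colour c (lookup e u) (lookup e w).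
      agree-step : ∀ {u w} → Edge T u w → lookup e u ≡ lookup e′ u → lookup e w ≡ lookup e′ w
      agree-step {u} {w} euw agree-u = proper-unique-neighbour proper
        (Edge-irrefl T euw ∘ lookup-injective distinct u w)
        (λ eq → Edge-irrefl T euw (lookup-injective distinct′ u w (trans (≡.sym agree-u) eq)))
        (trans (same-profile-colours e e′ same euw) (cong (λ t → c t (lookup e′ w)) (≡.sym agree-u)))
      agree-along : ∀ {u w} → Walk T u w → lookup e u ≡ lookup e′ u → lookup e w ≡ lookup e′ w
      agree-along here         agree = agree
      agree-along (step euw p) agree = agree-along p (agree-step euw agree)

  Disjoint : Vec (Fin n) v → Vec (Fin n) v → Set
  Disjoint a b = ∀ x y → lookup a x ≢ lookup b y

  disjoint? : ∀ a b → Dec (Disjoint a b)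
  disjoint? a b = all? (λ x → all? (λ y → ¬? (lookup a x ≟ lookup b y)))

  disjoint-sym : ∀ a b → Disjoint a b → Disjoint b a
  disjoint-sym _ _ disjoint x y eq = disjoint y x (≡.sym eq)

  class : List (Fin C) → List (Vec (Fin n) v)
  class π = filter (λ e → ≡-decList _≟_ (profile e) π) (arrangements v)

  ∈-class⁻ : ∀ {π e} → e ∈ class π → e ∈ arrangements v × profile e ≡ π
  ∈-class⁻ {π} = ∈-filter⁻ (λ e → ≡-decList _≟_ (profile e) π) {xs = arrangements v}

  -- A copy a meets at most v² members of its class: a member b meeting a at
  -- lookup a x = lookup b y is determined by the pair (x , y), by rigidity.
  class-meets : ∀ π {a} → a ∈ class π → length (filter (¬? ∘ disjoint? a) (class π)) ≤ v * v
  class-meets π {a} _ = begin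
      length meeting            ≤⟨ injection-bound (λ (x , y) b → lookup a x ≟ lookup b y) vertexPairs meeting meeting-unique cover determined ⟩
      length vertexPairs        ≡⟨ length-cartesianProduct (allFin v) (allFin v) ⟩
      length (allFin v) * length (allFin v) ≡⟨ cong₂ _*_ (length-allFin v) (length-allFin v) ⟩
      v * v                     ∎
    where
      meeting : List (Vec (Fin n) v)
      meeting = filter (¬? ∘ disjoint? a) (class π)
      meeting-unique : Unique meeting
      meeting-unique = Unique.filter⁺ _ (Unique.filter⁺ _ (arrangements-unique v))
      member : ∀ {b} → b ∈ meeting → b ∈ class π × ¬ Disjoint a b
      member = ∈-filter⁻ (¬? ∘ disjoint? a) {xs = class π}
      cover : ∀ {b} → b ∈ meeting → Any (λ (x , y) → lookup a x ≡ lookup b y) vertexPairs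
      cover {b} b∈ with ¬∀⟶∃¬ v _ (λ x → all? (λ y → ¬? (lookup a x ≟ lookup b y))) (proj₂ (member b∈))
      ... | x , ¬∀y with ¬∀⟶∃¬ v _ (λ y → ¬? (lookup a x ≟ lookup b y)) ¬∀y
      ... | y , ¬≢ = Any.map (λ { refl → decidable-stable (lookup a x ≟ lookup b y) ¬≢ })
                             (∈-cartesianProduct⁺ (∈-allFin x) (∈-allFin y))
      determined : ∀ (p : Fin v × Fin v) {b b′} → b ∈ meeting → b′ ∈ meeting →
                   lookup a (proj₁ p) ≡ lookup b (proj₂ p) → lookup a (proj₁ p) ≡ lookup b′ (proj₂ p) → b ≡ b′
      determined (x , y) b∈ b′∈ ax≡by ax≡b′y
        with ∈-class⁻ (proj₁ (member b∈)) | ∈-class⁻ (proj₁ (member b′∈))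
      ... | b∈arr , profile-b | b′∈arr , profile-b′ =
        rigidity (arrangement-distinct v b∈arr) (arrangement-distinct v b′∈arr)
                 (trans profile-b (≡.sym profile-b′)) y (trans (≡.sym ax≡by) ax≡b′y)

  class-repeat : ∀ {k π} (ψ : Fin k → Vec (Fin n) v) → (∀ i → ψ i ∈ class π) →
                 (∀ i j → i ≢ j → Disjoint (ψ i) (ψ j)) → KRepeat T k c
  class-repeat {π = π} ψ ψ∈ disjoint =
      (λ i → lookup (ψ i))
    , (λ i → lookup-injective (arrangement-distinct v (proj₁ (∈-class⁻ (ψ∈ i)))))
    , (λ i j x y i≢j → disjoint i j i≢j x y)
    , (λ i j x y exy → same-profile-colours (ψ i) (ψ j) (trans (proj₂ (∈-class⁻ (ψ∈ i))) (≡.sym (proj₂ (∈-class⁻ (ψ∈ j))))) exy)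

  class-bound : ∀ k → ¬ KRepeat T k c → ∀ π → length (class π) ≤ k * (v * v)
  class-bound k no-repeat π with k * (v * v) <? length (class π)
  ... | no  small = ≮⇒≥ small
  ... | yes large =
    let (ψ , ψ∈ , ψ-disjoint) = greedy-selection disjoint? disjoint-sym k (class π) (class-meets π) large
    in ⊥-elim (no-repeat (class-repeat ψ ψ∈ ψ-disjoint))

  copies-bound : ∀ k → ¬ KRepeat T k c → length (arrangements v) ≤ C ^ edgeCount T * (k * (v * v))
  copies-bound k no-repeat = begin
      length (arrangements v)                         ≤⟨ fibre-bound (λ π e → ≡-decList _≟_ (profile e) π) (words (edgeCount T)) (arrangements v) cover (class-bound k no-repeat) ⟩
      length (words (edgeCount T)) * (k * (v * v))    ≤⟨ *-monoˡ-≤ (k * (v * v)) (words-length (edgeCount T)) ⟩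
      C ^ edgeCount T * (k * (v * v))                 ∎
    where
      open Words C
      cover : ∀ {e} → e ∈ arrangements v → Any (λ π → profile e ≡ π) (words (edgeCount T))
      cover {e} _ = subst (λ m → profile e ∈ words m) (profile-length e) (∈-words (profile e))

-- Let T have v + 1 vertices and m ≥ 1 edges, and let n ≥ 2(v + 1).  A proper
-- colouring of K_n with C colours and no k-repeat of T satisfies
--   n ^ (m + 1) ≤ n ^ (v + 1) ≤ 2 ^ (v + 1) · #copies ≤ 2 ^ (v + 1) · C ^ m · k · (v + 1)²,
-- using m ≤ v for trees, the count of duplicate-free tuples, and copies-bound.
-- A graph without vertices has no edges, contradicting m ≥ 1.
proposition3p7 : ∀ {v} (T : Graph v) (m : ℕ) → IsTree T → edgeCount T ≡ m → 1 ≤ m →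
                 ∀ (k : ℕ) → 2 ≤ k →
                 Σ ℕ λ d → 1 ≤ d × Σ ℕ λ N → ∀ (n : ℕ) → N ≤ n →
                   ∀ (C : ℕ) (c : Colouring n C) → Proper c → ¬ KRepeat T k c →
                   n ^ suc m ≤ d * C ^ m
proposition3p7 {zero}  T .0 _                     refl ()  k _
proposition3p7 {suc v} T m  (connected , acyclic) refl _   k 2≤k = d , 1≤d , 2 * suc v , bound
  where
    d : ℕ
    d = 2 ^ suc v * (k * (suc v * suc v))

    1≤d : 1 ≤ d
    1≤d = *-mono-≤ (m^n>0 2 (suc v)) (*-mono-≤ (≤-trans (s≤s z≤n) 2≤k) (s≤s z≤n))

    bound : ∀ n → 2 * suc v ≤ n → ∀ C (c : Colouring n C) → Proper c → ¬ KRepeat T k c →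
            n ^ suc m ≤ d * C ^ m
    bound n 2v≤n C c proper no-repeat = begin
      n ^ suc m                                       ≤⟨ ^-monoʳ-≤ n {{>-nonZero (≤-trans (s≤s z≤n) 2v≤n)}} (s≤s (RootedTree.edgeCount-≤ T connected acyclic)) ⟩
      n ^ suc v                                       ≤⟨ Arrangements.arrangements-length n (suc v) 2v≤n ⟩
      2 ^ suc v * length (Arrangements.arrangements n (suc v))
                                                      ≤⟨ *-monoʳ-≤ (2 ^ suc v) (Copies.copies-bound T connected c proper k no-repeat) ⟩
      2 ^ suc v * (C ^ m * (k * (suc v * suc v)))     ≡⟨ rearrange (2 ^ suc v) (C ^ m) (k * (suc v * suc v)) ⟩
      d * C ^ m                                       ∎
      where
        open +-*-Solver
        rearrange : ∀ a b c → a * (b * c) ≡ (a * c) * b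
        rearrange = solve 3 (λ a b c → a :* (b :* c) := (a :* c) :* b) refl
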